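{- (1) A path connected finite space $P$ is contractible if and only if $\mathrm{CC}(P)=1$. (2) If $P$ and $Q$ are path connected finite spaces that are homotopy equivalent, then $\mathrm{CC}(P)=\mathrm{CC}(Q)$.
   Context: A finite space is a finite $T_0$ topological space, identified with a finite poset (open sets are down-sets; continuous maps are order-preserving maps). $J_m$ is the finite fence on $\{0,\dots,m\}$ with order $0<1>2<\cdots m$; $P^{J_m}$ is the finite space of continuous maps $J_m\to P$ with the pointwise order; $q_m(\gamma)=(\gamma(0),\gamma(m))$. $\mathrm{CC}_m(P)$ is the smallest $n\ge0$ such that some open cover $\{Q_i\}_{i=1}^n$ of $P\times P$ admits continuous sections $Q_i\to P^{J_m}$ of $q_m$ ($\infty$ if none), and the combinatorial complexity is $\mathrm{CC}(P)=\min_{m\ge0}\mathrm{CC}_m(P)$. -}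

module Defs where

open import Data.Nat using (ℕ; zero; suc; _%_) renaming (_≤_ to _≤ℕ_)
open import Data.Fin using (Fin; toℕ; fromℕ) renaming (zero to fzero)
open import Data.Product using (Σ; Σ-syntax; ∃; _×_; _,_; proj₁; proj₂)
open import Data.Sum using (_⊎_)
open import Relation.Binary.PropositionalEquality using (_≡_)
open import Relation.Binary.Structures using (IsPartialOrder)
open import Relation.Binary.Definitions using (Decidable)
open import Function.Bundles using (_↔_; _⇔_)

-- Finite spaces = finite posets (open sets = down-sets,
-- continuous maps = order-preserving maps).

record FinSpace : Set₁ where
  field
    Carrier        : Set
    _≤_            : Carrier → Carrier → Set
    isPartialOrder : IsPartialOrder _≡_ _≤_
    _≤?_           : Decidable _≤_
    finite         : Σ ℕ λ n → Carrier ↔ Fin n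

open FinSpace public using (Carrier)

_⊢_≤_ : (P : FinSpace) → Carrier P → Carrier P → Set
P ⊢ x ≤ y = FinSpace._≤_ P x y

record Map (P Q : FinSpace) : Set where
  field
    fun  : Carrier P → Carrier Q
    mono : ∀ {x y} → P ⊢ x ≤ y → Q ⊢ fun x ≤ fun y
open Map public

idMap : (P : FinSpace) → Map P P
idMap P = record { fun = λ x → x ; mono = λ p → p }

constMap : (P Q : FinSpace) → Carrier Q → Map P Q
constMap P Q q = record { fun = λ _ → q ; mono = λ _ → IsPartialOrder.refl (FinSpace.isPartialOrder Q) }

_∘M_ : {P Q R : FinSpace} → Map Q R → Map P Q → Map P R
g ∘M f = record { fun = λ x → fun g (fun f x) ; mono = λ p → mono g (mono f p) }

_≈M_ : {P Q : FinSpace} → Map P Q → Map P Q → Set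
_≈M_ {P} f g = ∀ (x : Carrier P) → fun f x ≡ fun g x

-- pointwise order of maps (order of the finite space Q^P)
_≤M_ : {P Q : FinSpace} → Map P Q → Map P Q → Set
_≤M_ {P} {Q} f g = ∀ (x : Carrier P) → Q ⊢ fun f x ≤ fun g x

-- The fence J_m on {0,…,m}: 0 < 1 > 2 < 3 > …
-- i.e. the odd points are maximal and each is above its neighbours:
-- i ≤ j  iff  i = j, or j is odd and |i - j| = 1.

Odd : ℕ → Set
Odd n = n % 2 ≡ 1

_≤J_ : {m : ℕ} → Fin (suc m) → Fin (suc m) → Set
i ≤J j = (i ≡ j) ⊎ (Odd (toℕ j) × ((toℕ i ≡ suc (toℕ j)) ⊎ (suc (toℕ i) ≡ toℕ j)))

J0 : {m : ℕ} → Fin (suc m)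
J0 = fzero

Jend : (m : ℕ) → Fin (suc m)
Jend m = fromℕ m

-- A point of P^{J_m}: a continuous map J_m → P.
record JPath (P : FinSpace) (m : ℕ) : Set where
  field
    pt   : Fin (suc m) → Carrier P
    mono : ∀ {i j : Fin (suc m)} → i ≤J j → P ⊢ pt i ≤ pt j
open JPath public

_≤P_ : {P : FinSpace} {m : ℕ} → JPath P m → JPath P m → Set
_≤P_ {P} {m} γ δ = ∀ (i : Fin (suc m)) → P ⊢ pt γ i ≤ pt δ i

PathConnected : FinSpace → Set
PathConnected P =
  Carrier P ×
  (∀ (x y : Carrier P) → Σ ℕ λ m → Σ (JPath P m) λ γ →
      (pt γ J0 ≡ x) × (pt γ (Jend m) ≡ y))

-- Homotopy of maps f g : P → Q: a path J_m → Q^P from f to g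
-- (continuous map J_m → Q^P, pointwise order on Q^P).
record Homotopy {P Q : FinSpace} (f g : Map P Q) : Set where
  field
    len   : ℕ
    H     : Fin (suc len) → Map P Q
    Hmono : ∀ {i j : Fin (suc len)} → i ≤J j → H i ≤M H j
    start : H J0 ≈M f
    end   : H (Jend len) ≈M g

Homotopic : {P Q : FinSpace} → Map P Q → Map P Q → Set
Homotopic f g = Homotopy f g

Contractible : FinSpace → Set
Contractible P = Σ (Carrier P) λ x₀ → Homotopic (idMap P) (constMap P P x₀)

HomotopyEquivalent : FinSpace → FinSpace → Set
HomotopyEquivalent P Q =
  Σ (Map P Q) λ f → Σ (Map Q P) λ g →
    Homotopic (g ∘M f) (idMap P) × Homotopic (f ∘M g) (idMap Q)

_⊢_≤²_ : (P : FinSpace) → Carrier P × Carrier P → Carrier P × Carrier P → Set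
P ⊢ (x , y) ≤² (x' , y') = (P ⊢ x ≤ x') × (P ⊢ y ≤ y')

-- open subsets of P × P are the down-sets
IsOpen² : (P : FinSpace) → (Carrier P × Carrier P → Set) → Set
IsOpen² P U = ∀ {z w} → P ⊢ w ≤² z → U z → U w

-- a continuous section over U of q_m : P^{J_m} → P × P, q_m(γ) = (γ(0), γ(m))
record Section (P : FinSpace) (m : ℕ) (U : Carrier P × Carrier P → Set) : Set where
  field
    s       : (z : Carrier P × Carrier P) → U z → JPath P m
    cont    : ∀ {z w} (u : U z) (v : U w) → P ⊢ z ≤² w → s z u ≤P s w v
    section : ∀ z (u : U z) → (pt (s z u) J0 , pt (s z u) (Jend m)) ≡ z

record HasCC (P : FinSpace) (m n : ℕ) : Set₁ where
  field
    Q        : Fin n → Carrier P × Carrier P → Set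
    open'    : ∀ i → IsOpen² P (Q i)
    covers   : ∀ z → Σ (Fin n) λ i → Q i z
    sections : ∀ i → Section P m (Q i)

-- CCis P k : CC(P) = min_m CC_m(P) = k, i.e. some m admits such a cover
-- with k members and no m admits one with fewer members.
CCis : FinSpace → ℕ → Set₁
CCis P k = (Σ ℕ λ m → HasCC P m k) × (∀ m j → HasCC P m j → k ≤ℕ j)

-- A section of q_m over U is a monotone family of fence paths, and a homotopy h ≃ h' gives
-- for every point a a fence path from h a to h' a depending monotonically on a.  Running
-- backwards along a homotopy f ∘ g ≃ id, then along f applied to a section of q_m for P over
-- g × g, then forwards along the homotopy again turns every cover of P × P with sections into
-- a cover of Q × Q with sections and the same number of sets; applied in both directions of a
-- homotopy equivalence this gives (2).  For (1), a contraction H to x₀ yields the global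
-- section (a , b) ↦ H(a) followed by H(b) reversed, and conversely a global section restricted
-- to P × {x₀} is a contraction.  Fence paths are concatenated and reversed in the shape of
-- zigzags v₀ ≤ p₀ ≥ v₁ ≤ p₁ ≥ ⋯, which avoids all parity bookkeeping on J_m.
module Submission where

open import Defs
open import Data.Nat using (ℕ; zero; suc; _+_; _∸_; _*_; ⌈_/2⌉; z≤n; s≤s) renaming (_≤_ to _≤ℕ_)
open import Data.Nat.Properties using (n∸n≡0)
open import Data.Fin using (Fin; toℕ; fromℕ) renaming (zero to fzero; suc to fsuc)
open import Data.Fin.Properties using (toℕ-fromℕ)
open import Data.Product using (Σ; _×_; _,_; proj₁; proj₂)
open import Data.Sum using (inj₁; inj₂)
open import Data.Unit using (⊤; tt)
open import Function using (_∘_)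
open import Function.Bundles using (_⇔_; mk⇔)
open import Relation.Binary.PropositionalEquality using (_≡_; refl; sym; trans; cong; cong₂; subst)
open import Relation.Binary.Structures using (IsPartialOrder)

≤-refl : (P : FinSpace) {x : Carrier P} → P ⊢ x ≤ x
≤-refl P = IsPartialOrder.refl (FinSpace.isPartialOrder P)

module _ {P : FinSpace} where

  -- splice K f g is f on [0, K) followed by g.
  splice : ℕ → (ℕ → Carrier P) → (ℕ → Carrier P) → ℕ → Carrier P
  splice zero    f g n       = g n
  splice (suc K) f g zero    = f zero
  splice (suc K) f g (suc n) = splice K (f ∘ suc) g n

  splice-start : ∀ K f g → f K ≡ g 0 → splice K f g 0 ≡ f 0
  splice-start zero    f g e = sym e
  splice-start (suc K) f g e = refl

  splice-end : ∀ K f g n → splice K f g (K + n) ≡ g n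
  splice-end zero    f g n = refl
  splice-end (suc K) f g n = splice-end K (f ∘ suc) g n

  splice-suc : ∀ K f g → f K ≡ g 0 → ∀ n → splice K f g (suc n) ≡ splice K (f ∘ suc) (g ∘ suc) n
  splice-suc zero    f g e n       = refl
  splice-suc (suc K) f g e zero    = splice-start K (f ∘ suc) g e
  splice-suc (suc K) f g e (suc n) = splice-suc K (f ∘ suc) g e n

  splice-mono : ∀ K {f g f′ g′} → (∀ n → P ⊢ f n ≤ f′ n) → (∀ n → P ⊢ g n ≤ g′ n) →
                ∀ n → P ⊢ splice K f g n ≤ splice K f′ g′ n
  splice-mono zero    f≤f′ g≤g′ n       = g≤g′ n
  splice-mono (suc K) f≤f′ g≤g′ zero    = f≤f′ 0
  splice-mono (suc K) f≤f′ g≤g′ (suc n) = splice-mono K (f≤f′ ∘ suc) g≤g′ n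

record Zigzag (P : FinSpace) : Set where
  field
    valley peak : ℕ → Carrier P
    ascent      : ∀ k → P ⊢ valley k ≤ peak k
    descent     : ∀ k → P ⊢ valley (suc k) ≤ peak k
open Zigzag

_≤Z_ : {P : FinSpace} → Zigzag P → Zigzag P → Set
_≤Z_ {P} z w = (∀ k → P ⊢ valley z k ≤ valley w k) × (∀ k → P ⊢ peak z k ≤ peak w k)

module _ {P : FinSpace} where

  concatZ : (K : ℕ) (z w : Zigzag P) → valley z K ≡ valley w 0 → Zigzag P
  concatZ K z w e = record
    { valley  = splice K (valley z) (valley w)
    ; peak    = splice K (peak z) (peak w)
    ; ascent  = splice-mono {P} K (ascent z) (ascent w)
    ; descent = λ k → subst (λ x → P ⊢ x ≤ splice K (peak z) (peak w) k)
                        (sym (splice-suc {P} K (valley z) (valley w) e k))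
                        (splice-mono {P} K (descent z) (descent w) k)
    }

  reverseZ : ℕ → Zigzag P → Zigzag P
  reverseZ K z = record
    { valley  = λ n → valley z (K ∸ n)
    ; peak    = λ n → peak z (K ∸ suc n)
    ; ascent  = reversed-ascent K
    ; descent = λ n → ascent z (K ∸ suc n)
    }
    where
    reversed-ascent : ∀ K n → P ⊢ valley z (K ∸ n) ≤ peak z (K ∸ suc n)
    reversed-ascent zero    zero    = ascent z 0
    reversed-ascent zero    (suc n) = ascent z 0
    reversed-ascent (suc K) zero    = descent z K
    reversed-ascent (suc K) (suc n) = reversed-ascent K n

mapZ : {P Q : FinSpace} → Map P Q → Zigzag P → Zigzag Q
mapZ f z = record
  { valley  = fun f ∘ valley z
  ; peak    = fun f ∘ peak z
  ; ascent  = Map.mono f ∘ ascent z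
  ; descent = Map.mono f ∘ descent z
  }

clamp : (m : ℕ) → ℕ → Fin (suc m)
clamp m       zero    = fzero
clamp zero    (suc n) = fzero
clamp (suc m) (suc n) = fsuc (clamp m n)

clamp-end : ∀ m → clamp m (⌈ m /2⌉ * 2) ≡ fromℕ m
clamp-end zero          = refl
clamp-end (suc zero)    = refl
clamp-end (suc (suc m)) = cong (fsuc ∘ fsuc) (clamp-end m)

fsuc²-≤J : ∀ {m} {i j : Fin (suc m)} → i ≤J j → fsuc (fsuc i) ≤J fsuc (fsuc j)
fsuc²-≤J (inj₁ refl)         = inj₁ refl
fsuc²-≤J (inj₂ (o , inj₁ e)) = inj₂ (o , inj₁ (cong (suc ∘ suc) e))
fsuc²-≤J (inj₂ (o , inj₂ e)) = inj₂ (o , inj₂ (cong (suc ∘ suc) e))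

module _ {P : FinSpace} where

  FenceMono : (m : ℕ) → (Fin (suc m) → Carrier P) → Set
  FenceMono m p = ∀ {i j} → i ≤J j → P ⊢ p i ≤ p j

  clamp-ascent : ∀ m p → FenceMono m p → ∀ k → P ⊢ p (clamp m (k * 2)) ≤ p (clamp m (suc (k * 2)))
  clamp-ascent zero          p mono zero    = ≤-refl P
  clamp-ascent zero          p mono (suc k) = ≤-refl P
  clamp-ascent (suc m)       p mono zero    = mono (inj₂ (refl , inj₂ refl))
  clamp-ascent (suc zero)    p mono (suc k) = ≤-refl P
  clamp-ascent (suc (suc m)) p mono (suc k) = clamp-ascent m (p ∘ fsuc ∘ fsuc) (mono ∘ fsuc²-≤J) k

  clamp-descent : ∀ m p → FenceMono m p → ∀ k → P ⊢ p (clamp m (suc k * 2)) ≤ p (clamp m (suc (k * 2)))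
  clamp-descent zero          p mono k       = ≤-refl P
  clamp-descent (suc zero)    p mono zero    = ≤-refl P
  clamp-descent (suc zero)    p mono (suc k) = ≤-refl P
  clamp-descent (suc (suc m)) p mono zero    = mono (inj₂ (refl , inj₁ refl))
  clamp-descent (suc (suc m)) p mono (suc k) = clamp-descent m (p ∘ fsuc ∘ fsuc) (mono ∘ fsuc²-≤J) k

  -- A fence path of length m as a zigzag of length ⌈ m /2⌉, constant after its end.
  sampleZ : {m : ℕ} → JPath P m → Zigzag P
  sampleZ {m} γ = record
    { valley  = λ k → pt γ (clamp m (k * 2))
    ; peak    = λ k → pt γ (clamp m (suc (k * 2)))
    ; ascent  = clamp-ascent m (pt γ) (JPath.mono γ)
    ; descent = clamp-descent m (pt γ) (JPath.mono γ)
    }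

  sampleZ-end : ∀ {m} (γ : JPath P m) → valley (sampleZ γ) ⌈ m /2⌉ ≡ pt γ (Jend m)
  sampleZ-end {m} γ = cong (pt γ) (clamp-end m)

  sampleZ-mono : ∀ {m} (γ δ : JPath P m) → γ ≤P δ → sampleZ γ ≤Z sampleZ δ
  sampleZ-mono {m} _ _ γ≤δ = (λ k → γ≤δ (clamp m (k * 2))) , (λ k → γ≤δ (clamp m (suc (k * 2))))

  -- Fence point 2k is valley k and fence point 2k + 1 is peak k.
  fence : Zigzag P → ℕ → Carrier P
  fence z zero          = valley z 0
  fence z (suc zero)    = peak z 0
  fence z (suc (suc n)) = fence (tail z) n
    where
    tail : Zigzag P → Zigzag P
    tail z = record { valley = valley z ∘ suc ; peak = peak z ∘ suc
                    ; ascent = ascent z ∘ suc ; descent = descent z ∘ suc }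

  fence-up : ∀ z n → Odd (suc n) → P ⊢ fence z n ≤ fence z (suc n)
  fence-up z zero          o = ascent z 0
  fence-up z (suc zero)    ()
  fence-up z (suc (suc n)) o = fence-up _ n o

  fence-down : ∀ z n → Odd n → P ⊢ fence z (suc n) ≤ fence z n
  fence-down z zero          ()
  fence-down z (suc zero)    o = descent z 0
  fence-down z (suc (suc n)) o = fence-down _ n o

  fence-mono : ∀ {z w} → z ≤Z w → ∀ n → P ⊢ fence z n ≤ fence w n
  fence-mono z≤w zero          = proj₁ z≤w 0
  fence-mono z≤w (suc zero)    = proj₂ z≤w 0
  fence-mono z≤w (suc (suc n)) = fence-mono (proj₁ z≤w ∘ suc , proj₂ z≤w ∘ suc) n

  fence-valley : ∀ z K → fence z (K * 2) ≡ valley z K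
  fence-valley z zero    = refl
  fence-valley z (suc K) = fence-valley _ K

  toJPath : (K : ℕ) → Zigzag P → JPath P (K * 2)
  toJPath K z = record { pt = fence z ∘ toℕ ; mono = fence-ordered }
    where
    fence-ordered : FenceMono (K * 2) (fence z ∘ toℕ)
    fence-ordered (inj₁ refl)                     = ≤-refl P
    fence-ordered {i} {j} (inj₂ (o , inj₁ i≡j+1)) =
      subst (λ n → P ⊢ fence z n ≤ fence z (toℕ j)) (sym i≡j+1) (fence-down z (toℕ j) o)
    fence-ordered {i} {j} (inj₂ (o , inj₂ i+1≡j)) =
      subst (λ n → P ⊢ fence z (toℕ i) ≤ fence z n) i+1≡j
            (fence-up z (toℕ i) (subst Odd (sym i+1≡j) o))

  toJPath-end : ∀ K z → pt (toJPath K z) (Jend (K * 2)) ≡ valley z K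
  toJPath-end K z = trans (cong (fence z) (toℕ-fromℕ (K * 2))) (fence-valley z K)

record ZigzagFamily {I : Set} (_≼_ : I → I → Set) (P : FinSpace) (K : ℕ) (src tgt : I → Carrier P) :
                    Set where
  field
    path     : I → Zigzag P
    monotone : ∀ {i j} → i ≼ j → path i ≤Z path j
    starts   : ∀ i → valley (path i) 0 ≡ src i
    ends     : ∀ i → valley (path i) K ≡ tgt i
open ZigzagFamily

module _ {I : Set} {_≼_ : I → I → Set} {P : FinSpace} where

  _++F_ : ∀ {K L s t u} → ZigzagFamily _≼_ P K s t → ZigzagFamily _≼_ P L t u →
          ZigzagFamily _≼_ P (K + L) s u
  _++F_ {K} {L} F G = record
    { path     = λ i → concatZ K (path F i) (path G i) (join i)
    ; monotone = λ i≼j → splice-mono {P} K (proj₁ (monotone F i≼j)) (proj₁ (monotone G i≼j))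
                       , splice-mono {P} K (proj₂ (monotone F i≼j)) (proj₂ (monotone G i≼j))
    ; starts   = λ i → trans (splice-start {P} K (valley (path F i)) (valley (path G i)) (join i))
                             (starts F i)
    ; ends     = λ i → trans (splice-end {P} K (valley (path F i)) (valley (path G i)) L) (ends G i)
    }
    where
    join : ∀ i → valley (path F i) K ≡ valley (path G i) 0
    join i = trans (ends F i) (sym (starts G i))

  reverseF : ∀ {K s t} → ZigzagFamily _≼_ P K s t → ZigzagFamily _≼_ P K t s
  reverseF {K} F = record
    { path     = reverseZ K ∘ path F
    ; monotone = λ i≼j → (λ n → proj₁ (monotone F i≼j) (K ∸ n))
                       , (λ n → proj₂ (monotone F i≼j) (K ∸ suc n))
    ; starts   = ends F
    ; ends     = λ i → trans (cong (valley (path F i)) (n∸n≡0 K)) (starts F i)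
    }

  mapF : ∀ {Q K s t} (f : Map P Q) → ZigzagFamily _≼_ P K s t →
         ZigzagFamily _≼_ Q K (fun f ∘ s) (fun f ∘ t)
  mapF f F = record
    { path     = mapZ f ∘ path F
    ; monotone = λ i≼j → (Map.mono f ∘ proj₁ (monotone F i≼j)) , (Map.mono f ∘ proj₂ (monotone F i≼j))
    ; starts   = cong (fun f) ∘ starts F
    ; ends     = cong (fun f) ∘ ends F
    }

  reindexF : ∀ {J : Set} {_⊑_ : J → J → Set} {K s t} (h : J → I) → (∀ {i j} → i ⊑ j → h i ≼ h j) →
             ZigzagFamily _≼_ P K s t → ZigzagFamily _⊑_ P K (s ∘ h) (t ∘ h)
  reindexF h h-mono F = record
    { path     = path F ∘ h
    ; monotone = monotone F ∘ h-mono
    ; starts   = starts F ∘ h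
    ; ends     = ends F ∘ h
    }

trajectories : {P Q : FinSpace} {f g : Map P Q} (H : Homotopy f g) →
               ZigzagFamily (P ⊢_≤_) Q ⌈ Homotopy.len H /2⌉ (fun f) (fun g)
trajectories {P} {Q} H = record
  { path     = sampleZ ∘ trajectory
  ; monotone = λ {a} {b} a≤b →
                 sampleZ-mono (trajectory a) (trajectory b) (λ i → Map.mono (Homotopy.H H i) a≤b)
  ; starts   = Homotopy.start H
  ; ends     = λ a → trans (sampleZ-end (trajectory a)) (Homotopy.end H a)
  }
  where
  trajectory : Carrier P → JPath Q (Homotopy.len H)
  trajectory a = record { pt = λ i → fun (Homotopy.H H i) a ; mono = λ i≤j → Homotopy.Hmono H i≤j a }

Subspace≤ : (P : FinSpace) (U : Carrier P × Carrier P → Set) → Σ _ U → Σ _ U → Set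
Subspace≤ P U u v = P ⊢ proj₁ u ≤² proj₁ v

SectionFamily : (P : FinSpace) → (Carrier P × Carrier P → Set) → ℕ → Set
SectionFamily P U K = ZigzagFamily (Subspace≤ P U) P K (proj₁ ∘ proj₁) (proj₂ ∘ proj₁)

module _ {P : FinSpace} {U : Carrier P × Carrier P → Set} where

  section⇒family : ∀ {m} → Section P m U → SectionFamily P U ⌈ m /2⌉
  section⇒family S = record
    { path     = λ (z , u) → sampleZ (Section.s S z u)
    ; monotone = λ {(z , u)} {(w , v)} z≤w →
                   sampleZ-mono (Section.s S z u) (Section.s S w v) (Section.cont S u v z≤w)
    ; starts   = λ (z , u) → cong proj₁ (Section.section S z u)
    ; ends     = λ (z , u) → trans (sampleZ-end (Section.s S z u)) (cong proj₂ (Section.section S z u))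
    }

  family⇒section : ∀ {K} → SectionFamily P U K → Section P (K * 2) U
  family⇒section {K} F = record
    { s       = λ z u → toJPath K (path F (z , u))
    ; cont    = λ u v z≤w i → fence-mono {P} (monotone F z≤w) (toℕ i)
    ; section = λ z u → cong₂ _,_ (starts F (z , u))
                                  (trans (toJPath-end K (path F (z , u))) (ends F (z , u)))
    }

HasCC-dominated : {P Q : FinSpace} (f : Map P Q) (g : Map Q P) → Homotopy (f ∘M g) (idMap Q) →
                  ∀ {m n} → HasCC P m n → Σ ℕ λ m′ → HasCC Q m′ n
HasCC-dominated {P} {Q} f g fg≃id {m} {n} C = _ , record
  { Q        = V
  ; open'    = λ i (a≤a′ , b≤b′) → HasCC.open' C i (Map.mono g a≤a′ , Map.mono g b≤b′)
  ; covers   = HasCC.covers C ∘ g²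
  ; sections = family⇒section ∘ transported
  }
  where
  g² : Carrier Q × Carrier Q → Carrier P × Carrier P
  g² (a , b) = fun g a , fun g b

  V : Fin n → Carrier Q × Carrier Q → Set
  V i = HasCC.Q C i ∘ g²

  L : ℕ
  L = ⌈ Homotopy.len fg≃id /2⌉

  T : ZigzagFamily (Q ⊢_≤_) Q L (fun (f ∘M g)) (fun (idMap Q))
  T = trajectories fg≃id

  pullback : ∀ i → Σ _ (V i) → Σ _ (HasCC.Q C i)
  pullback i (z , u) = g² z , u

  pullback-mono : ∀ i {u v} → Subspace≤ Q (V i) u v →
                  Subspace≤ P (HasCC.Q C i) (pullback i u) (pullback i v)
  pullback-mono i (a≤a′ , b≤b′) = Map.mono g a≤a′ , Map.mono g b≤b′

  transported : ∀ i → SectionFamily Q (V i) (L + (⌈ m /2⌉ + L))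
  transported i =
    reverseF (reindexF (proj₁ ∘ proj₁) proj₁ T)
      ++F (mapF f (reindexF (pullback i) (λ {u} {v} → pullback-mono i {u} {v})
                     (section⇒family (HasCC.sections C i)))
      ++F reindexF (proj₂ ∘ proj₁) proj₂ T)

contractible⇒HasCC1 : {P : FinSpace} → Contractible P → Σ ℕ λ m → HasCC P m 1
contractible⇒HasCC1 (x₀ , H) = _ , record
  { Q        = λ _ _ → ⊤
  ; open'    = λ _ _ _ → tt
  ; covers   = λ _ → fzero , tt
  ; sections = λ _ → family⇒section
      (reindexF (proj₁ ∘ proj₁) proj₁ (trajectories H)
        ++F reverseF (reindexF (proj₂ ∘ proj₁) proj₂ (trajectories H)))
  }

HasCC1⇒contractible : {P : FinSpace} {m : ℕ} → Carrier P → HasCC P m 1 → Contractible P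
HasCC1⇒contractible {P} {m} x₀ C = x₀ , record
  { len   = m
  ; H     = contraction
  ; Hmono = λ i≤j a → JPath.mono (γ a) i≤j
  ; start = λ a → cong proj₁ (Section.section S (a , x₀) (toward a))
  ; end   = λ a → cong proj₂ (Section.section S (a , x₀) (toward a))
  }
  where
  S : Section P m (HasCC.Q C fzero)
  S = HasCC.sections C fzero

  toward : ∀ a → HasCC.Q C fzero (a , x₀)
  toward a with HasCC.covers C (a , x₀)
  ... | fzero , u = u

  γ : Carrier P → JPath P m
  γ a = Section.s S (a , x₀) (toward a)

  contraction : Fin (suc m) → Map P P
  contraction i = record
    { fun  = λ a → pt (γ a) i
    ; mono = λ {a} {b} a≤b → Section.cont S (toward a) (toward b) (a≤b , ≤-refl P) i
    }

HasCC-positive : {P : FinSpace} {m n : ℕ} → Carrier P → HasCC P m n → 1 ≤ℕ n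
HasCC-positive {n = zero} x C with HasCC.covers C (x , x)
... | () , _
HasCC-positive {n = suc n} x C = s≤s z≤n

CCis-dominated : {P Q : FinSpace} (f : Map P Q) (g : Map Q P) →
                 Homotopy (g ∘M f) (idMap P) → Homotopy (f ∘M g) (idMap Q) →
                 ∀ {k} → CCis P k → CCis Q k
CCis-dominated f g gf≃id fg≃id ((_ , C) , minimal) =
  HasCC-dominated f g fg≃id C , λ _ j C′ → minimal _ j (proj₂ (HasCC-dominated g f gf≃id C′))

-- Path connectedness is only used through nonemptiness, in (1).
corollary3p7 :
    ((P : FinSpace) → PathConnected P → (Contractible P ⇔ CCis P 1))
    × ((P Q : FinSpace) → PathConnected P → PathConnected Q →
        HomotopyEquivalent P Q → (k : ℕ) → (CCis P k ⇔ CCis Q k))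
corollary3p7 =
  (λ P (x , _) → mk⇔ (λ c → contractible⇒HasCC1 c , λ _ _ → HasCC-positive x)
                     (λ ((_ , C) , _) → HasCC1⇒contractible x C))
  , λ P Q _ _ (f , g , gf≃id , fg≃id) k →
      mk⇔ (CCis-dominated f g gf≃id fg≃id) (CCis-dominated g f fg≃id gf≃id)
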